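{- The set of equations $\{$(BE1), (BE2), (BI1), (BI2), (BI3)$\}$ is independent: for each of these five equations there is an algebra $(A;\wedge,\vee,\cdot,\to,B,0,1)$, whose reduct $(A;\wedge,\vee,\cdot,\to,0,1)$ is a residuated lattice and $B$ is a unary operation, which satisfies the other four equations but not that one. Here, with $x\preccurlyeq y$ abbreviating $x\vee y\approx y$ and $\neg x=x\to0$: (BE1) $Bx\preccurlyeq x$; (BE2) $Bx\vee\neg Bx\approx1$; (BI1) $Bx\preccurlyeq B(x\vee y)$; (BI2) $B1\approx1$; (BI3) $B(x\vee\neg x)\preccurlyeq Bx\vee\neg x$.
   Context: A residuated lattice is an algebra $(A;\wedge,\vee,\cdot,\to,0,1)$ with $(A;\wedge,\vee,0,1)$ a bounded lattice ($0$ least, $1$ greatest), $(A;\cdot,1)$ a commutative monoid, and $a\cdot b\le c$ iff $a\le b\to c$. -}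

module Defs where

open import Level using (0ℓ)
open import Data.Product using (Σ; _×_; _,_)
open import Relation.Binary.PropositionalEquality using (_≡_)
open import Relation.Nullary using (¬_)

record RLB : Set₁ where
  infixr 6 _∧_
  infixr 5 _∨_
  infixl 7 _·_
  infixr 4 _⇒_
  infix 3 _≤_
  field
    A   : Set
    _∧_ _∨_ _·_ _⇒_ : A → A → A
    B   : A → A
    𝟘 𝟙 : A
    ∧-comm  : ∀ x y → x ∧ y ≡ y ∧ x
    ∨-comm  : ∀ x y → x ∨ y ≡ y ∨ x
    ∧-assoc : ∀ x y z → (x ∧ y) ∧ z ≡ x ∧ (y ∧ z)
    ∨-assoc : ∀ x y z → (x ∨ y) ∨ z ≡ x ∨ (y ∨ z)
    ∧-absorb : ∀ x y → x ∧ (x ∨ y) ≡ x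
    ∨-absorb : ∀ x y → x ∨ (x ∧ y) ≡ x
    𝟘-least    : ∀ x → 𝟘 ∨ x ≡ x
    𝟙-greatest : ∀ x → x ∨ 𝟙 ≡ 𝟙
    ·-comm  : ∀ x y → x · y ≡ y · x
    ·-assoc : ∀ x y z → (x · y) · z ≡ x · (y · z)
    ·-identity : ∀ x → 𝟙 · x ≡ x

  _≤_ : A → A → Set
  x ≤ y = x ∨ y ≡ y

  field
    residuation₁ : ∀ a b c → a · b ≤ c → a ≤ (b ⇒ c)
    residuation₂ : ∀ a b c → a ≤ (b ⇒ c) → a · b ≤ c

  ¬ᵣ_ : A → A
  ¬ᵣ x = x ⇒ 𝟘

module _ (𝔸 : RLB) where
  open RLB 𝔸

  BE1 : Set
  BE1 = ∀ x → B x ∨ x ≡ x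

  BE2 : Set
  BE2 = ∀ x → B x ∨ (¬ᵣ (B x)) ≡ 𝟙

  BI1 : Set
  BI1 = ∀ x y → B x ∨ B (x ∨ y) ≡ B (x ∨ y)

  BI2 : Set
  BI2 = B 𝟙 ≡ 𝟙

  BI3 : Set
  BI3 = ∀ x → B (x ∨ (¬ᵣ x)) ∨ (B x ∨ (¬ᵣ x)) ≡ B x ∨ (¬ᵣ x)

-- All five witnesses are Heyting algebras (residuated lattices with x · y = x ∧ y)
-- built from the chains 2 and 3: a chain with the Gödel implication
-- (x ⇒ y = 1 if x ≤ y, and y otherwise) is residuated, and residuation survives
-- products.  Over 2, 3, 2 × 2 and 2 × 3 the operator B is chosen to break exactly
-- one equation, and since the carriers are finite all five equations are then
-- settled by exhaustive search.
module Submission where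

open import Defs
open import Level using (0ℓ)
open import Data.Fin using (Fin; zero; fromℕ)
open import Data.Fin.Properties using (≤-isDecTotalOrder; ≤fromℕ; all?)
  renaming (_≟_ to _≟ᶠ_)
open import Data.Nat using (ℕ; suc; z≤n)
open import Data.Product using (Σ; _×_; _,_; uncurry; zip′)
open import Data.Product.Properties using (,-injectiveˡ; ,-injectiveʳ; ≡-dec)
open import Data.Sum using (inj₁; inj₂)
open import Relation.Binary using (Rel; IsDecTotalOrder; TotalOrder; Minimum; Maximum; DecidableEquality)
open import Relation.Binary.PropositionalEquality using (_≡_; cong₂; subst)
open import Relation.Nullary using (¬_; Dec; yes; no; contradiction)
open import Relation.Nullary.Decidable using (map′; from-yes; from-no)
open import Relation.Unary using (Pred; Decidable)
open import Function using (_∘_; id)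
import Algebra.Construct.NaturalChoice.Min as Min
import Algebra.Construct.NaturalChoice.Max as Max
import Algebra.Construct.NaturalChoice.MinMaxOp as MinMaxOp

record ResiduatedLattice : Set₁ where
  infixr 6 _∧_
  infixr 5 _∨_
  infixl 7 _·_
  infixr 4 _⇒_
  infix 3 _≤_
  field
    A   : Set
    _∧_ _∨_ _·_ _⇒_ : A → A → A
    𝟘 𝟙 : A
    ∧-comm  : ∀ x y → x ∧ y ≡ y ∧ x
    ∨-comm  : ∀ x y → x ∨ y ≡ y ∨ x
    ∧-assoc : ∀ x y z → (x ∧ y) ∧ z ≡ x ∧ (y ∧ z)
    ∨-assoc : ∀ x y z → (x ∨ y) ∨ z ≡ x ∨ (y ∨ z)
    ∧-absorb : ∀ x y → x ∧ (x ∨ y) ≡ x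
    ∨-absorb : ∀ x y → x ∨ (x ∧ y) ≡ x
    𝟘-least    : ∀ x → 𝟘 ∨ x ≡ x
    𝟙-greatest : ∀ x → x ∨ 𝟙 ≡ 𝟙
    ·-comm  : ∀ x y → x · y ≡ y · x
    ·-assoc : ∀ x y z → (x · y) · z ≡ x · (y · z)
    ·-identity : ∀ x → 𝟙 · x ≡ x

  _≤_ : A → A → Set
  x ≤ y = x ∨ y ≡ y

  field
    residuation₁ : ∀ a b c → a · b ≤ c → a ≤ (b ⇒ c)
    residuation₂ : ∀ a b c → a ≤ (b ⇒ c) → a · b ≤ c

expand : (L : ResiduatedLattice) → (ResiduatedLattice.A L → ResiduatedLattice.A L) → RLB
expand L B = record { ResiduatedLattice L ; B = B }

module Chain {A : Set} {_≤_ : Rel A 0ℓ} (isDecTotalOrder : IsDecTotalOrder _≡_ _≤_)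
             {⊥ ⊤ : A} (⊥-minimum : Minimum _≤_ ⊥) (⊤-maximum : Maximum _≤_ ⊤) where

  open IsDecTotalOrder isDecTotalOrder using (isTotalOrder; _≤?_)

  totalOrder : TotalOrder 0ℓ 0ℓ 0ℓ
  totalOrder = record { isTotalOrder = isTotalOrder }

  open Min totalOrder using (_⊓_; minOperator)
  open Max totalOrder using (_⊔_; maxOperator; x≤y⇒x⊔y≈y)
  open MinMaxOp minOperator maxOperator

  infixr 4 _⇒_

  _⇒_ : A → A → A
  x ⇒ y with x ≤? y
  ... | yes _ = ⊤
  ... | no  _ = y

  x⊓y≤z⇒x≤y⇒z : ∀ x y z → (x ⊓ y) ≤ z → x ≤ (y ⇒ z)
  x⊓y≤z⇒x≤y⇒z x y z x⊓y≤z with y ≤? z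
  ... | yes _   = ⊤-maximum x
  ... | no  y≰z with ⊓-sel x y
  ...   | inj₁ x⊓y≡x = subst (_≤ z) x⊓y≡x x⊓y≤z
  ...   | inj₂ x⊓y≡y = contradiction (subst (_≤ z) x⊓y≡y x⊓y≤z) y≰z

  x≤y⇒z⇒x⊓y≤z : ∀ x y z → x ≤ (y ⇒ z) → (x ⊓ y) ≤ z
  x≤y⇒z⇒x⊓y≤z x y z x≤y⇒z with y ≤? z
  ... | yes y≤z = x≤y⇒z⊓x≤y x y≤z
  ... | no  _   = x≤y⇒x⊓z≤y y x≤y⇒z

  residuatedLattice : ResiduatedLattice
  residuatedLattice = record
    { A = A ; _∧_ = _⊓_ ; _∨_ = _⊔_ ; _·_ = _⊓_ ; _⇒_ = _⇒_ ; 𝟘 = ⊥ ; 𝟙 = ⊤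
    ; ∧-comm = ⊓-comm ; ∨-comm = ⊔-comm ; ∧-assoc = ⊓-assoc ; ∨-assoc = ⊔-assoc
    ; ∧-absorb = ⊓-absorbs-⊔ ; ∨-absorb = ⊔-absorbs-⊓
    ; 𝟘-least = ⊔-identityˡ ⊥-minimum ; 𝟙-greatest = ⊔-zeroʳ ⊤-maximum
    ; ·-comm = ⊓-comm ; ·-assoc = ⊓-assoc ; ·-identity = ⊓-identityˡ ⊤-maximum
    ; residuation₁ = λ a b c → x≤y⇒x⊔y≈y ∘ x⊓y≤z⇒x≤y⇒z a b c ∘ x⊔y≈y⇒x≤y
    ; residuation₂ = λ a b c → x≤y⇒x⊔y≈y ∘ x≤y⇒z⇒x⊓y≤z a b c ∘ x⊔y≈y⇒x≤y
    }

chain : ℕ → ResiduatedLattice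
chain n = Chain.residuatedLattice (≤-isDecTotalOrder {suc n}) {zero} {fromℕ n} (λ _ → z≤n) ≤fromℕ

module _ (L M : ResiduatedLattice) where
  private
    module L = ResiduatedLattice L
    module M = ResiduatedLattice M

  _×ᴿ_ : ResiduatedLattice
  _×ᴿ_ = record
    { A = L.A × M.A
    ; _∧_ = zip′ L._∧_ M._∧_ ; _∨_ = zip′ L._∨_ M._∨_
    ; _·_ = zip′ L._·_ M._·_ ; _⇒_ = zip′ L._⇒_ M._⇒_
    ; 𝟘 = L.𝟘 , M.𝟘 ; 𝟙 = L.𝟙 , M.𝟙
    ; ∧-comm = λ (x , y) (x′ , y′) → cong₂ _,_ (L.∧-comm x x′) (M.∧-comm y y′)
    ; ∨-comm = λ (x , y) (x′ , y′) → cong₂ _,_ (L.∨-comm x x′) (M.∨-comm y y′)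
    ; ∧-assoc = λ (x , y) (x′ , y′) (x″ , y″) → cong₂ _,_ (L.∧-assoc x x′ x″) (M.∧-assoc y y′ y″)
    ; ∨-assoc = λ (x , y) (x′ , y′) (x″ , y″) → cong₂ _,_ (L.∨-assoc x x′ x″) (M.∨-assoc y y′ y″)
    ; ∧-absorb = λ (x , y) (x′ , y′) → cong₂ _,_ (L.∧-absorb x x′) (M.∧-absorb y y′)
    ; ∨-absorb = λ (x , y) (x′ , y′) → cong₂ _,_ (L.∨-absorb x x′) (M.∨-absorb y y′)
    ; 𝟘-least = λ (x , y) → cong₂ _,_ (L.𝟘-least x) (M.𝟘-least y)
    ; 𝟙-greatest = λ (x , y) → cong₂ _,_ (L.𝟙-greatest x) (M.𝟙-greatest y)
    ; ·-comm = λ (x , y) (x′ , y′) → cong₂ _,_ (L.·-comm x x′) (M.·-comm y y′)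
    ; ·-assoc = λ (x , y) (x′ , y′) (x″ , y″) → cong₂ _,_ (L.·-assoc x x′ x″) (M.·-assoc y y′ y″)
    ; ·-identity = λ (x , y) → cong₂ _,_ (L.·-identity x) (M.·-identity y)
    ; residuation₁ = λ (a , a′) (b , b′) (c , c′) h →
        cong₂ _,_ (L.residuation₁ a b c (,-injectiveˡ h)) (M.residuation₁ a′ b′ c′ (,-injectiveʳ h))
    ; residuation₂ = λ (a , a′) (b , b′) (c , c′) h →
        cong₂ _,_ (L.residuation₂ a b c (,-injectiveˡ h)) (M.residuation₂ a′ b′ c′ (,-injectiveʳ h))
    }

Exhaustible : Set → Set₁
Exhaustible A = ∀ {P : Pred A 0ℓ} → Decidable P → Dec (∀ x → P x)

×-exhaustible : ∀ {A B} → Exhaustible A → Exhaustible B → Exhaustible (A × B)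
×-exhaustible ∀A? ∀B? P? = map′ uncurry (λ ∀P x y → ∀P (x , y)) (∀A? λ x → ∀B? λ y → P? (x , y))

module Decide (𝔸 : RLB) (_≟_ : DecidableEquality (RLB.A 𝔸)) (∀? : Exhaustible (RLB.A 𝔸)) where
  open RLB 𝔸

  BE1? : Dec (BE1 𝔸)
  BE1? = ∀? λ x → (B x ∨ x) ≟ x

  BE2? : Dec (BE2 𝔸)
  BE2? = ∀? λ x → (B x ∨ ¬ᵣ B x) ≟ 𝟙

  BI1? : Dec (BI1 𝔸)
  BI1? = ∀? λ x → ∀? λ y → (B x ∨ B (x ∨ y)) ≟ B (x ∨ y)

  BI2? : Dec (BI2 𝔸)
  BI2? = B 𝟙 ≟ 𝟙

  BI3? : Dec (BI3 𝔸)
  BI3? = ∀? λ x → (B (x ∨ ¬ᵣ x) ∨ (B x ∨ ¬ᵣ x)) ≟ (B x ∨ ¬ᵣ x)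

𝟚 𝟛 : ResiduatedLattice
𝟚 = chain 1
𝟛 = chain 2

module _ (L : ResiduatedLattice) (_≟_ : DecidableEquality (ResiduatedLattice.A L)) where
  open ResiduatedLattice L

  complemented-or-𝟘 : A → A
  complemented-or-𝟘 x with (x ∨ (x ⇒ 𝟘)) ≟ 𝟙
  ... | yes _ = x
  ... | no  _ = 𝟘

¬BE1-witness : Σ RLB λ 𝔸 → ¬ BE1 𝔸 × BE2 𝔸 × BI1 𝔸 × BI2 𝔸 × BI3 𝔸
¬BE1-witness = 𝔸 , from-no BE1? , from-yes BE2? , from-yes BI1? , from-yes BI2? , from-yes BI3?
  where
    open ResiduatedLattice 𝟚 using (𝟙)
    𝔸 : RLB
    𝔸 = expand 𝟚 (λ _ → 𝟙)
    open Decide 𝔸 _≟ᶠ_ all?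

-- The middle element of 3 has pseudocomplement 0, so it is not complemented.
¬BE2-witness : Σ RLB λ 𝔸 → BE1 𝔸 × ¬ BE2 𝔸 × BI1 𝔸 × BI2 𝔸 × BI3 𝔸
¬BE2-witness = 𝔸 , from-yes BE1? , from-no BE2? , from-yes BI1? , from-yes BI2? , from-yes BI3?
  where
    𝔸 : RLB
    𝔸 = expand 𝟛 id
    open Decide 𝔸 _≟ᶠ_ all?

-- (1 , 0) is complemented in 2 × 3 but (1 , 1) above it is not, so B sends
-- (1 , 0) to itself and (1 , 1) to 0.
¬BI1-witness : Σ RLB λ 𝔸 → BE1 𝔸 × BE2 𝔸 × ¬ BI1 𝔸 × BI2 𝔸 × BI3 𝔸
¬BI1-witness = 𝔸 , from-yes BE1? , from-yes BE2? , from-no BI1? , from-yes BI2? , from-yes BI3?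
  where
    _≟_ : DecidableEquality (Fin 2 × Fin 3)
    _≟_ = ≡-dec _≟ᶠ_ _≟ᶠ_
    𝔸 : RLB
    𝔸 = expand (𝟚 ×ᴿ 𝟛) (complemented-or-𝟘 (𝟚 ×ᴿ 𝟛) _≟_)
    open Decide 𝔸 _≟_ (×-exhaustible all? all?)

¬BI2-witness : Σ RLB λ 𝔸 → BE1 𝔸 × BE2 𝔸 × BI1 𝔸 × ¬ BI2 𝔸 × BI3 𝔸
¬BI2-witness = 𝔸 , from-yes BE1? , from-yes BE2? , from-yes BI1? , from-no BI2? , from-yes BI3?
  where
    open ResiduatedLattice 𝟚 using (𝟘)
    𝔸 : RLB
    𝔸 = expand 𝟚 (λ _ → 𝟘)
    open Decide 𝔸 _≟ᶠ_ all?

-- At x = (1 , 0): B (x ∨ ¬ x) = B 1 = 1, while B x ∨ ¬ x = (0 , 1).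
¬BI3-witness : Σ RLB λ 𝔸 → BE1 𝔸 × BE2 𝔸 × BI1 𝔸 × BI2 𝔸 × ¬ BI3 𝔸
¬BI3-witness = 𝔸 , from-yes BE1? , from-yes BE2? , from-yes BI1? , from-yes BI2? , from-no BI3?
  where
    open ResiduatedLattice 𝟚 using (_∧_)
    𝔸 : RLB
    𝔸 = expand (𝟚 ×ᴿ 𝟚) (λ (x , y) → x ∧ y , y)
    open Decide 𝔸 (≡-dec _≟ᶠ_ _≟ᶠ_) (×-exhaustible all? all?)

proposition10 : (Σ RLB λ 𝔸 → ¬ BE1 𝔸 × BE2 𝔸 × BI1 𝔸 × BI2 𝔸 × BI3 𝔸)
    × (Σ RLB λ 𝔸 → BE1 𝔸 × ¬ BE2 𝔸 × BI1 𝔸 × BI2 𝔸 × BI3 𝔸)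
    × (Σ RLB λ 𝔸 → BE1 𝔸 × BE2 𝔸 × ¬ BI1 𝔸 × BI2 𝔸 × BI3 𝔸)
    × (Σ RLB λ 𝔸 → BE1 𝔸 × BE2 𝔸 × BI1 𝔸 × ¬ BI2 𝔸 × BI3 𝔸)
    × (Σ RLB λ 𝔸 → BE1 𝔸 × BE2 𝔸 × BI1 𝔸 × BI2 𝔸 × ¬ BI3 𝔸)
proposition10 = ¬BE1-witness , ¬BE2-witness , ¬BI1-witness , ¬BI2-witness , ¬BI3-witness
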